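{- A permutation $\pi\in{\cal S}_n$ is bi-increasing if and only if \[\pi=(s_{i_1+j_1-1}s_{i_1+j_1-2}\cdots s_{i_1})(s_{i_2+j_2-1}s_{i_2+j_2-2}\cdots s_{i_2})\cdots(s_{i_e+j_e-1}s_{i_e+j_e-2}\cdots s_{i_e})\] for some $e\ge0$ and positive integers $i_1,\ldots,i_e$ and $j_1,\ldots,j_e$ satisfying $1\le i_1<i_2<\cdots<i_e<n$ and $1<i_1+j_1<i_2+j_2<\cdots<i_e+j_e\le n$. In this case $i_1,\ldots,i_e$ are precisely the excedances of $\pi$.
   Context: Permutations $\pi\in{\cal S}_n$ are written as words $\pi_1\cdots\pi_n$ with $\pi_i=\pi(i)$; products of permutations are compositions of maps, $(\sigma\tau)(i)=\sigma(\tau(i))$, and the empty product is the identity. For $i=1,\ldots,n-1$, $s_i$ denotes the adjacent transposition $(i,i+1)$. An excedance of $\pi$ is an integer $i\in[n-1]$ with $\pi_i>i$; ${\sf E}(\pi)$ is the set of excedances. The excedance difference is ${\sf dexc}(\pi)=\sum_{i\in{\sf E}(\pi)}(\pi_i-i)$, and ${\sf inv}(\pi)$ is the number of pairs $i<j$ with $\pi_i>\pi_j$. A permutation $\pi$ is called bi-increasing if ${\sf inv}(\pi)={\sf dexc}(\pi)$. -}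

module Defs where

open import Data.Nat using (ℕ; zero; suc; _+_; _∸_; _≤_; _<_; _≡ᵇ_)
open import Data.Bool using (if_then_else_)
open import Data.Fin using (Fin; toℕ)
import Data.Fin as F
open import Data.Fin.Permutation using (Permutation′; _⟨$⟩ʳ_)
open import Data.List using (List; []; _∷_; length; filter; map; allFin; cartesianProduct)
open import Data.Nat.ListAction using (sum)
open import Data.List.Relation.Unary.All using (All)
open import Data.List.Relation.Unary.Linked using (Linked)
open import Data.List.Membership.Propositional using (_∈_)
open import Data.Product using (_×_; _,_; proj₁; proj₂)
open import Relation.Nullary using (yes; no; Dec)
open import Relation.Binary.PropositionalEquality using (_≡_)
open import Function using (_∘_; id)

-- Position x : Fin n stands for the integer
-- toℕ x + 1 ∈ [n] and the value π x stands for toℕ (π x) + 1.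

-- x is an excedance of π :  π_x > x   (the shift by 1 cancels)
IsExc : ∀ {n} → Permutation′ n → Fin n → Set
IsExc π x = x F.< (π ⟨$⟩ʳ x)

dexc : ∀ {n} → Permutation′ n → ℕ
dexc {n} π = sum (map term (allFin n))
  where
  term : Fin n → ℕ
  term x with x F.<? (π ⟨$⟩ʳ x)
  ... | yes _ = toℕ (π ⟨$⟩ʳ x) ∸ toℕ x
  ... | no  _ = 0

inv : ∀ {n} → Permutation′ n → ℕ
inv {n} π = length (filter isInv (cartesianProduct (allFin n) (allFin n)))
  where
  isInv : (p : Fin n × Fin n) → Dec ((proj₁ p F.< proj₂ p) × ((π ⟨$⟩ʳ proj₂ p) F.< (π ⟨$⟩ʳ proj₁ p)))
  isInv (i , j) with i F.<? j | (π ⟨$⟩ʳ j) F.<? (π ⟨$⟩ʳ i)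
  ... | yes a | yes b = yes (a , b)
  ... | no ¬a | _     = no (λ q → ¬a (proj₁ q))
  ... | yes _ | no ¬b = no (λ q → ¬b (proj₂ q))

BiIncreasing : ∀ {n} → Permutation′ n → Set
BiIncreasing π = inv π ≡ dexc π

-- The adjacent transposition s_k = (k, k+1), acting on positive integers
-- (1-based).  Only used with 1 ≤ k ≤ n-1, where it restricts to [n].
s : ℕ → ℕ → ℕ
s k p = if p ≡ᵇ k then suc k else (if p ≡ᵇ suc k then k else p)

cyc : ℕ → ℕ → ℕ → ℕ
cyc i zero    = id
cyc i (suc j) = s (i + j) ∘ cyc i j

word : List (ℕ × ℕ) → ℕ → ℕ
word []              = id
word ((i , j) ∷ ps) = cyc i j ∘ word ps

IncrPair : ℕ × ℕ → ℕ × ℕ → Set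
IncrPair (i , j) (i' , j') = (i < i') × (i + j < i' + j')

GoodPair : ℕ → ℕ × ℕ → Set
GoodPair n (i , j) = (1 ≤ i) × (1 ≤ j) × (i < n) × (1 < i + j) × (i + j ≤ n)

ValidPairs : ℕ → List (ℕ × ℕ) → Set
ValidPairs n ps = All (GoodPair n) ps × Linked IncrPair ps

Represents : ∀ {n} → Permutation′ n → List (ℕ × ℕ) → Set
Represents {n} π ps = ∀ (x : Fin n) → suc (toℕ (π ⟨$⟩ʳ x)) ≡ word ps (suc (toℕ x))

-- Let r(x) be the number of inversions (x, y) of π and l(x) the number of y < x with π_y < π_x.
-- The values below π_x lie on the two sides of x, so π_x = l(x) + r(x), and l(x) ≤ x gives
-- π_x - x ≤ r(x) at every position. Hence inv π ≥ dexc π, with equality exactly when every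
-- inversion (i, j) of π has i an excedance and j a non-excedance.
--
-- The cycle s_{i+j-1} ⋯ s_i sends i to i + j, moves i+1, …, i+j down by one and fixes the rest.
-- For pairs ordered as in the statement the product therefore sends each i_k to i_k + j_k, its
-- excedances are exactly the i_k, and each of its inversions runs from an excedance to a
-- non-excedance. Conversely, two injections with the same image that agree on a set E containing
-- the start of each of their inversions are equal (compare them at the first position where they
-- differ); applied to π and to the product built from its excedances i with j = π_i - i, this
-- gives the required factorisation of every bi-increasing π.

module Submission where

open import Defs
open import Data.Nat using (ℕ; zero; suc; _+_; _∸_; _≤_; _<_; _≟_; _<?_; _≤?_; z≤n; s≤s)
open import Data.Nat.Properties
import Data.Nat.ListAction as List
open import Data.Nat.ListAction.Properties using (sum-++)
open import Data.Fin using (Fin; toℕ)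
import Data.Fin as F
import Data.Fin.Properties as F
open import Data.Fin.Induction using (<-wellFounded)
open import Data.Fin.Permutation using (Permutation′; _⟨$⟩ʳ_; _⟨$⟩ˡ_; inverseʳ)
open import Data.List using (List; []; _∷_; _++_; map; allFin; tabulate; filter; length; cartesianProduct)
open import Data.List.Properties using (map-cong; map-tabulate; map-++; map-∘)
open import Data.List.Membership.Propositional using (_∈_)
open import Data.List.Membership.Propositional.Properties
  using (∈-map⁺; ∈-map⁻; ∈-filter⁺; ∈-map∘filter⁻; ∈-allFin)
open import Data.List.Relation.Unary.Any using (here; there)
open import Data.List.Relation.Unary.All as All using (All; []; _∷_)
open import Data.List.Relation.Unary.All.Properties using (all-filter)
open import Data.List.Relation.Unary.AllPairs using (AllPairs; []; _∷_)
import Data.List.Relation.Unary.AllPairs.Properties as AllPairs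
open import Data.List.Relation.Unary.Linked.Properties using (AllPairs⇒Linked; Linked⇒AllPairs)
open import Data.Product using (Σ; ∃-syntax; _×_; _,_; proj₁; proj₂)
open import Data.Sum using (_⊎_; inj₁; inj₂)
open import Data.Empty using (⊥; ⊥-elim)
open import Relation.Nullary using (¬_; Dec; yes; no; contradiction)
open import Relation.Nullary.Decidable using (_×-dec_; dec-true; dec-false)
open import Relation.Unary using (Pred; Decidable; _⊆_)
open import Relation.Unary.Properties using (_∩?_; ∁?)
open import Relation.Binary.Definitions using (tri<; tri≈; tri>)
open import Relation.Binary.PropositionalEquality
open import Function using (_∘_; id; Injective; _⇔_; mk⇔; Equivalence; Injection)
open import Function.Properties.Inverse using (Inverse⇒Injection)
import Function.Properties.Equivalence as ⇔
import Induction.WellFounded as WF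
open import Level using (0ℓ)
open import Algebra.Properties.CommutativeMonoid.Sum +-0-commutativeMonoid
  using (sum; sum-cong-≗; ∑-distrib-+; sum-permute; sum-replicate-zero)

private
  variable
    A B : Set

s-at : ∀ k → s k k ≡ suc k
s-at k rewrite dec-true (k ≟ k) refl = refl

s-at-suc : ∀ k → s k (suc k) ≡ k
s-at-suc k rewrite dec-false (suc k ≟ k) 1+n≢n | dec-true (k ≟ k) refl = refl

s-elsewhere : ∀ k {p} → p ≢ k → p ≢ suc k → s k p ≡ p
s-elsewhere k {p} p≢k p≢1+k rewrite dec-false (p ≟ k) p≢k | dec-false (p ≟ suc k) p≢1+k = refl

s-involutive : ∀ k p → s k (s k p) ≡ p
s-involutive k p with p ≟ k | p ≟ suc k
... | yes refl | _        = trans (cong (s p) (s-at p)) (s-at-suc p)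
... | no _     | yes refl = trans (cong (s k) (s-at-suc k)) (s-at k)
... | no p≢k   | no p≢1+k = trans (cong (s k) (s-elsewhere k p≢k p≢1+k)) (s-elsewhere k p≢k p≢1+k)

s-injective : ∀ k {p q} → s k p ≡ s k q → p ≡ q
s-injective k {p} {q} eq = begin
  p             ≡⟨ s-involutive k p ⟨
  s k (s k p)   ≡⟨ cong (s k) eq ⟩
  s k (s k q)   ≡⟨ s-involutive k q ⟩
  q             ∎
  where open ≡-Reasoning

cyc-start : ∀ a j → cyc a j a ≡ a + j
cyc-start a zero    = sym (+-identityʳ a)
cyc-start a (suc j) = begin
  s (a + j) (cyc a j a)  ≡⟨ cong (s (a + j)) (cyc-start a j) ⟩
  s (a + j) (a + j)      ≡⟨ s-at (a + j) ⟩
  suc (a + j)            ≡⟨ +-suc a j ⟨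
  a + suc j              ∎
  where open ≡-Reasoning

cyc-below : ∀ a j {v} → v < a → cyc a j v ≡ v
cyc-below a zero    v<a = refl
cyc-below a (suc j) v<a = trans (cong (s (a + j)) (cyc-below a j v<a))
  (s-elsewhere (a + j) (<⇒≢ v<a+j) (<⇒≢ (m<n⇒m<1+n v<a+j)))
  where v<a+j = <-≤-trans v<a (m≤m+n a j)

cyc-above : ∀ a j {v} → a + j < v → cyc a j v ≡ v
cyc-above a zero    a+j<v = refl
cyc-above a (suc j) a+j<v rewrite +-suc a j =
  trans (cong (s (a + j)) (cyc-above a j (<-trans (n<1+n (a + j)) a+j<v)))
    (s-elsewhere (a + j) (>⇒≢ (<-trans (n<1+n (a + j)) a+j<v)) (>⇒≢ a+j<v))

cyc-shift : ∀ a j {v} → a ≤ v → v < a + j → cyc a j (suc v) ≡ v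
cyc-shift a zero    {v} a≤v v<a+0 = ⊥-elim (<⇒≱ (subst (v <_) (+-identityʳ a) v<a+0) a≤v)
cyc-shift a (suc j) {v} a≤v v<a+1+j with m<1+n⇒m<n∨m≡n (subst (v <_) (+-suc a j) v<a+1+j)
... | inj₁ v<a+j = trans (cong (s (a + j)) (cyc-shift a j a≤v v<a+j))
      (s-elsewhere (a + j) (<⇒≢ v<a+j) (<⇒≢ (m<n⇒m<1+n v<a+j)))
... | inj₂ refl  = trans (cong (s (a + j)) (cyc-above a j (n<1+n (a + j)))) (s-at-suc (a + j))

cyc-off-start : ∀ a j {v} → v ≢ a → cyc a j v ≡ v ⊎ (a < v × suc (cyc a j v) ≡ v)
cyc-off-start a j {v} v≢a with <-cmp v a
... | tri< v<a _ _ = inj₁ (cyc-below a j v<a)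
... | tri≈ _ v≡a _ = ⊥-elim (v≢a v≡a)
cyc-off-start a j {suc w} v≢a | tri> _ _ (s≤s a≤w) with suc w ≤? a + j
... | yes v≤a+j = inj₂ (s≤s a≤w , cong suc (cyc-shift a j a≤w v≤a+j))
... | no  v≰a+j = inj₁ (cyc-above a j (≰⇒> v≰a+j))

cyc-≤ : ∀ a j {v} → v ≢ a → cyc a j v ≤ v
cyc-≤ a j {v} v≢a with cyc-off-start a j v≢a
... | inj₁ eq = ≤-reflexive eq
... | inj₂ (_ , eq) = subst (cyc a j v ≤_) eq (n≤1+n _)

cyc-≥ : ∀ a j {v} → v ≢ a → v ≤ suc (cyc a j v)
cyc-≥ a j {v} v≢a with cyc-off-start a j v≢a
... | inj₁ eq = subst (_≤ suc (cyc a j v)) eq (n≤1+n _)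
... | inj₂ (_ , eq) = ≤-reflexive (sym eq)

cyc-monotone : ∀ a j {u w} → u ≢ a → w ≢ a → u < w → cyc a j u ≤ cyc a j w
cyc-monotone a j u≢a w≢a u<w = ≤-trans (cyc-≤ a j u≢a) (≤-pred (≤-trans u<w (cyc-≥ a j w≢a)))

cyc-injective : ∀ a j {p q} → cyc a j p ≡ cyc a j q → p ≡ q
cyc-injective a zero    eq = eq
cyc-injective a (suc j) eq = cyc-injective a j (s-injective (a + j) eq)

InRange : ℕ → ℕ → Set
InRange n v = 1 ≤ v × v ≤ n

module _ {n : ℕ} where

  suc-toℕ-inRange : (x : Fin n) → InRange n (suc (toℕ x))
  suc-toℕ-inRange x = s≤s z≤n , F.toℕ<n x

  inRange⇒suc-toℕ : ∀ {v} → InRange n v → Σ (Fin n) λ x → v ≡ suc (toℕ x)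
  inRange⇒suc-toℕ {suc v} (_ , v<n) = F.fromℕ< v<n , cong suc (sym (F.toℕ-fromℕ< v<n))

cyc-inRange : ∀ {n} a j → 1 ≤ a → a + j ≤ n → ∀ {v} → InRange n v → InRange n (cyc a j v)
cyc-inRange a j 1≤a a+j≤n {v} (1≤v , v≤n) with v ≟ a
... | yes refl = subst (InRange _) (sym (cyc-start a j)) (≤-trans 1≤a (m≤m+n a j) , a+j≤n)
... | no v≢a with cyc-off-start a j v≢a
...   | inj₁ eq = subst (InRange _) (sym eq) (1≤v , v≤n)
...   | inj₂ (a<v , eq) =
  ≤-trans 1≤a (≤-pred (subst (a <_) (sym eq) a<v)) , ≤-trans (cyc-≤ a j v≢a) v≤n

cyc-surjective : ∀ {n} a j → 1 ≤ a → a + j ≤ n →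
                 ∀ {v} → InRange n v → ∃[ p ] InRange n p × cyc a j p ≡ v
cyc-surjective a j 1≤a a+j≤n {v} v∈ with <-cmp v (a + j)
... | tri≈ _ refl _ = a , (1≤a , ≤-trans (m≤m+n a j) a+j≤n) , cyc-start a j
... | tri> _ _ a+j<v = v , v∈ , cyc-above a j a+j<v
... | tri< v<a+j _ _ with v <? a
...   | yes v<a = v , v∈ , cyc-below a j v<a
...   | no  v≮a = suc v , (s≤s z≤n , ≤-trans v<a+j a+j≤n) , cyc-shift a j (≮⇒≥ v≮a) v<a+j

Sorted : List (ℕ × ℕ) → Set
Sorted = AllPairs IncrPair

Positive : List (ℕ × ℕ) → Set
Positive = All ((1 ≤_) ∘ proj₂)

IncrPair-trans : ∀ {x y z} → IncrPair x y → IncrPair y z → IncrPair x z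
IncrPair-trans (i<i′ , e<e′) (i′<i″ , e′<e″) = <-trans i<i′ i′<i″ , <-trans e<e′ e′<e″

module _ {n : ℕ} where

  valid⇒positive : ∀ {ps} → ValidPairs n ps → Positive ps
  valid⇒positive = All.map (proj₁ ∘ proj₂) ∘ proj₁

  valid⇒sorted : ∀ {ps} → ValidPairs n ps → Sorted ps
  valid⇒sorted = Linked⇒AllPairs IncrPair-trans ∘ proj₂

word-below : ∀ ps {p} → All ((p <_) ∘ proj₁) ps → word ps p ≡ p
word-below []             []             = refl
word-below ((a , j) ∷ qs) (p<a ∷ p<qs) = trans (cong (cyc a j) (word-below qs p<qs)) (cyc-below a j p<a)

word-injective : ∀ ps {p q} → word ps p ≡ word ps q → p ≡ q
word-injective []             eq = eq
word-injective ((a , j) ∷ qs) eq = word-injective qs (cyc-injective a j eq)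

module _ {a j : ℕ} {qs : List (ℕ × ℕ)} (a,j≺qs : All (IncrPair (a , j)) qs) where

  word-tail-fixes-head : word qs a ≡ a
  word-tail-fixes-head = word-below qs (All.map proj₁ a,j≺qs)

  word-tail-avoids-head : ∀ {p} → p ≢ a → word qs p ≢ a
  word-tail-avoids-head p≢a eq = p≢a (word-injective qs (trans eq (sym word-tail-fixes-head)))

  cyc-fixes-tail-ends : ∀ {i j′} → (i , j′) ∈ qs → cyc a j (i + j′) ≡ i + j′
  cyc-fixes-tail-ends mem = cyc-above a j (proj₂ (All.lookup a,j≺qs mem))

word-start : ∀ ps → Sorted ps → ∀ {i j} → (i , j) ∈ ps → word ps i ≡ i + j
word-start ((a , j) ∷ qs) (a,j≺qs ∷ _) (here refl) =
  trans (cong (cyc a j) (word-tail-fixes-head a,j≺qs)) (cyc-start a j)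
word-start ((a , j) ∷ qs) (a,j≺qs ∷ sorted) (there mem) =
  trans (cong (cyc a j) (word-start qs sorted mem)) (cyc-fixes-tail-ends a,j≺qs mem)

word-excedance : ∀ ps → Sorted ps → ∀ {p} → p < word ps p → ∃[ j ] (p , j) ∈ ps × word ps p ≡ p + j
word-excedance []             _ p<p = ⊥-elim (<-irrefl refl p<p)
word-excedance ((a , j) ∷ qs) sorted@(a,j≺qs ∷ sorted′) {p} p<fp with p ≟ a
... | yes refl = j , here refl , word-start _ sorted (here refl)
... | no p≢a
  with word-excedance qs sorted′ (<-≤-trans p<fp (cyc-≤ a j (word-tail-avoids-head a,j≺qs p≢a)))
...   | j′ , mem , gp≡p+j′ =
  j′ , there mem , trans (cong (cyc a j) gp≡p+j′) (cyc-fixes-tail-ends a,j≺qs mem)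

word-tail-excedances-above-head : ∀ {a j qs} → All (IncrPair (a , j)) qs → Sorted qs →
                             ∀ {v} → v < word qs v → a + j < word qs v
word-tail-excedances-above-head a,j≺qs sorted v<gv with word-excedance _ sorted v<gv
... | _ , mem , gv≡v+j′ = subst (_ <_) (sym gv≡v+j′) (proj₂ (All.lookup a,j≺qs mem))

word-inversion : ∀ ps → Positive ps → Sorted ps → ∀ {p q} → p < q → word ps q < word ps p →
                 p < word ps p × word ps q ≤ q
word-inversion []             _ _ p<q fq<fp = ⊥-elim (<-asym p<q fq<fp)
word-inversion ((a , j) ∷ qs) (1≤j ∷ positive) sorted@(a,j≺qs ∷ sorted′) {p} {q} p<q fq<fp
  with p ≟ a | q ≟ a
... | yes refl | _ = subst (p <_) (sym fa≡a+j) (m<m+n p 1≤j) , fq≤q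
  where
  fa≡a+j = word-start _ sorted (here refl)
  fq≤q : cyc a j (word qs q) ≤ q
  fq≤q with q <? word qs q
  ... | yes q<gq = ⊥-elim (<-asym fq<fp (subst₂ _<_ (sym fa≡a+j) (sym (cyc-above a j a+j<gq)) a+j<gq))
    where a+j<gq = word-tail-excedances-above-head a,j≺qs sorted′ q<gq
  ... | no  q≮gq = ≤-trans (cyc-≤ a j (word-tail-avoids-head a,j≺qs (>⇒≢ p<q))) (≮⇒≥ q≮gq)
... | no _ | yes refl =
  ⊥-elim (<-asym fq<fp (subst₂ _<_ (sym fp≡p) (sym fq≡q+j) (<-≤-trans p<q (m≤m+n q j))))
  where
  fp≡p = word-below ((q , j) ∷ qs) (p<q ∷ All.map (<-trans p<q ∘ proj₁) a,j≺qs)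
  fq≡q+j = word-start _ sorted (here refl)
... | no p≢a | no q≢a with <-cmp (word qs p) (word qs q)
...   | tri< gp<gq _ _ = ⊥-elim (<⇒≱ fq<fp
  (cyc-monotone a j (word-tail-avoids-head a,j≺qs p≢a) (word-tail-avoids-head a,j≺qs q≢a) gp<gq))
...   | tri≈ _ gp≡gq _ = ⊥-elim (<-irrefl (cong (cyc a j) (sym gp≡gq)) fq<fp)
...   | tri> _ _ gq<gp with word-inversion qs positive sorted′ p<q gq<gp
...     | p<gp , gq≤q =
  subst (p <_) (sym (cyc-above a j (word-tail-excedances-above-head a,j≺qs sorted′ p<gp))) p<gp ,
  ≤-trans (cyc-≤ a j (word-tail-avoids-head a,j≺qs q≢a)) gq≤q

word-excedance⇔ : ∀ ps → Positive ps → Sorted ps → ∀ p → (p < word ps p ⇔ p ∈ map proj₁ ps)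
word-excedance⇔ ps positive sorted p = mk⇔ to from
  where
  to : p < word ps p → p ∈ map proj₁ ps
  to p<fp = ∈-map⁺ proj₁ (proj₁ (proj₂ (word-excedance ps sorted p<fp)))
  from : p ∈ map proj₁ ps → p < word ps p
  from p∈ with ∈-map⁻ proj₁ p∈
  ... | (_ , j) , mem , refl =
    subst (p <_) (sym (word-start ps sorted mem)) (m<m+n p (All.lookup positive mem))

word-inRange : ∀ {n} ps → All (GoodPair n) ps → ∀ {v} → InRange n v → InRange n (word ps v)
word-inRange []             []                                  v∈ = v∈
word-inRange ((a , j) ∷ qs) ((1≤a , _ , _ , _ , a+j≤n) ∷ good) v∈ =
  cyc-inRange a j 1≤a a+j≤n (word-inRange qs good v∈)

word-surjective : ∀ {n} ps → All (GoodPair n) ps →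
                  ∀ {v} → InRange n v → ∃[ p ] InRange n p × word ps p ≡ v
word-surjective []             []                                  {v} v∈ = v , v∈ , refl
word-surjective ((a , j) ∷ qs) ((1≤a , _ , _ , _ , a+j≤n) ∷ good) v∈
  with cyc-surjective a j 1≤a a+j≤n v∈
... | u , u∈ , cu≡v with word-surjective qs good u∈
...   | p , p∈ , gp≡u = p , p∈ , trans (cong (cyc a j) gp≡u) cu≡v


indicator : Dec A → ℕ
indicator (yes _) = 1
indicator (no  _) = 0

indicator-mono : (a? : Dec A) (b? : Dec B) → (A → B) → indicator a? ≤ indicator b?
indicator-mono (yes a) (yes _) _   = ≤-refl
indicator-mono (yes a) (no ¬b) a→b = contradiction (a→b a) ¬b
indicator-mono (no _)  _       _   = z≤n

indicator-cong : (a? : Dec A) (b? : Dec B) → (A → B) → (B → A) → indicator a? ≡ indicator b?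
indicator-cong a? b? a→b b→a = ≤-antisym (indicator-mono a? b? a→b) (indicator-mono b? a? b→a)

indicator-≡⇒ : (a? : Dec A) (b? : Dec B) → indicator a? ≡ indicator b? → B → A
indicator-≡⇒ (yes a) _      _  _ = a
indicator-≡⇒ (no _) (yes _) () _
indicator-≡⇒ (no _) (no ¬b) _  b = contradiction b ¬b

≤-+-≡⇒≡ˡ : ∀ {a b c d} → a ≤ c → b ≤ d → a + b ≡ c + d → a ≡ c
≤-+-≡⇒≡ˡ a≤c b≤d eq = ≤-antisym a≤c (≮⇒≥ λ a<c → <-irrefl eq (+-mono-<-≤ a<c b≤d))

sum-mono-≤ : ∀ {n} {f g : Fin n → ℕ} → (∀ i → f i ≤ g i) → sum f ≤ sum g
sum-mono-≤ {zero}  _   = z≤n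
sum-mono-≤ {suc n} f≤g = +-mono-≤ (f≤g F.zero) (sum-mono-≤ (f≤g ∘ F.suc))

sum-mono-≤-≡⇒≗ : ∀ {n} {f g : Fin n → ℕ} → (∀ i → f i ≤ g i) → sum f ≡ sum g →
                 ∀ i → f i ≡ g i
sum-mono-≤-≡⇒≗ {suc n}         f≤g eq F.zero    =
  ≤-+-≡⇒≡ˡ (f≤g F.zero) (sum-mono-≤ (f≤g ∘ F.suc)) eq
sum-mono-≤-≡⇒≗ {suc n} {f} {g} f≤g eq (F.suc i) = sum-mono-≤-≡⇒≗ (f≤g ∘ F.suc) tail-eq i
  where
  head-eq = sum-mono-≤-≡⇒≗ f≤g eq F.zero
  tail-eq = +-cancelˡ-≡ (f F.zero) _ _ (trans eq (cong (_+ sum (g ∘ F.suc)) (sym head-eq)))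

count : ∀ {n} {P : Pred (Fin n) 0ℓ} → Decidable P → ℕ
count P? = sum (indicator ∘ P?)

module _ {n} {P Q : Pred (Fin n) 0ℓ} (P? : Decidable P) (Q? : Decidable Q) where

  count-mono : P ⊆ Q → count P? ≤ count Q?
  count-mono P⊆Q = sum-mono-≤ λ i → indicator-mono (P? i) (Q? i) P⊆Q

  count-cong : P ⊆ Q → Q ⊆ P → count P? ≡ count Q?
  count-cong P⊆Q Q⊆P = sum-cong-≗ λ i → indicator-cong (P? i) (Q? i) P⊆Q Q⊆P

  count-≡⇒⊇ : P ⊆ Q → count P? ≡ count Q? → Q ⊆ P
  count-≡⇒⊇ P⊆Q eq {i} = indicator-≡⇒ (P? i) (Q? i)
    (sum-mono-≤-≡⇒≗ (λ i → indicator-mono (P? i) (Q? i) P⊆Q) eq i)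

  count-∩-∁ : count P? ≡ count (P? ∩? Q?) + count (P? ∩? ∁? Q?)
  count-∩-∁ =
    trans (sum-cong-≗ split) (∑-distrib-+ (indicator ∘ (P? ∩? Q?)) (indicator ∘ (P? ∩? ∁? Q?)))
    where
    split : ∀ i → indicator (P? i) ≡ indicator ((P? ∩? Q?) i) + indicator ((P? ∩? ∁? Q?) i)
    split i with P? i | Q? i
    ... | yes _ | yes _ = refl
    ... | yes _ | no  _ = refl
    ... | no  _ | _     = refl

module _ {n} {P : Pred (Fin n) 0ℓ} (P? : Decidable P) where

  count-∅ : (∀ i → ¬ P i) → count P? ≡ 0
  count-∅ ¬P =
    trans (sum-cong-≗ λ i → indicator-cong (P? i) (no λ ()) (¬P i) λ ()) (sum-replicate-zero n)

  count-permute : (π : Permutation′ n) → count (P? ∘ (π ⟨$⟩ʳ_)) ≡ count P?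
  count-permute π = sym (sum-permute (indicator ∘ P?) π)

count-≡0 : ∀ {n} {P : Pred (Fin n) 0ℓ} (P? : Decidable P) → count P? ≡ 0 → ∀ i → ¬ P i
count-≡0 P? eq i = count-≡⇒⊇ ∅? P? (λ ()) (trans (count-∅ ∅? (λ _ ())) (sym eq))
  where
  ∅? : Decidable (λ _ → ⊥)
  ∅? _ = no λ ()

count-toℕ< : ∀ n m → m ≤ n → count (λ (i : Fin n) → toℕ i <? m) ≡ m
count-toℕ< zero    zero    _         = refl
count-toℕ< (suc n) zero    _         = count-∅ {suc n} (λ i → toℕ i <? 0) (λ _ ())
count-toℕ< (suc n) (suc m) (s≤s m≤n) = cong suc (trans
  (count-cong {n} (λ i → suc (toℕ i) <? suc m) (λ i → toℕ i <? m) ≤-pred s≤s)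
  (count-toℕ< n m m≤n))


length-filter : ∀ {A : Set} {P : Pred A 0ℓ} (P? : Decidable P) xs →
                length (filter P? xs) ≡ List.sum (map (indicator ∘ P?) xs)
length-filter P? []       = refl
length-filter P? (x ∷ xs) with P? x
... | yes _ = cong suc (length-filter P? xs)
... | no  _ = length-filter P? xs

sum-cartesianProduct : ∀ {A B : Set} (h : A × B → ℕ) xs ys →
  List.sum (map h (cartesianProduct xs ys)) ≡
  List.sum (map (λ x → List.sum (map (λ y → h (x , y)) ys)) xs)
sum-cartesianProduct h []       ys = refl
sum-cartesianProduct h (x ∷ xs) ys = begin
  List.sum (map h (map (x ,_) ys ++ cartesianProduct xs ys))
    ≡⟨ cong List.sum (map-++ h (map (x ,_) ys) _) ⟩
  List.sum (map h (map (x ,_) ys) ++ map h (cartesianProduct xs ys))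
    ≡⟨ sum-++ (map h (map (x ,_) ys)) _ ⟩
  List.sum (map h (map (x ,_) ys)) + List.sum (map h (cartesianProduct xs ys))
    ≡⟨ cong₂ _+_ (cong List.sum (sym (map-∘ ys))) (sum-cartesianProduct h xs ys) ⟩
  List.sum (map (λ y → h (x , y)) ys) + List.sum (map (λ x → List.sum (map (λ y → h (x , y)) ys)) xs)
    ∎
  where open ≡-Reasoning

sum-tabulate : ∀ {n} (h : Fin n → ℕ) → List.sum (tabulate h) ≡ sum h
sum-tabulate {zero}  h = refl
sum-tabulate {suc n} h = cong (h F.zero +_) (sum-tabulate (h ∘ F.suc))

sum-allFin : ∀ {n} (h : Fin n → ℕ) → List.sum (map h (allFin n)) ≡ sum h
sum-allFin h = trans (cong List.sum (map-tabulate (λ i → i) h)) (sum-tabulate h)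

length-filter-pairs : ∀ {n} {P : Pred (Fin n × Fin n) 0ℓ} (P? : Decidable P) →
  length (filter P? (cartesianProduct (allFin n) (allFin n))) ≡ sum (λ i → count (λ j → P? (i , j)))
length-filter-pairs {n} P? = begin
  length (filter P? (cartesianProduct (allFin n) (allFin n)))
    ≡⟨ length-filter P? (cartesianProduct (allFin n) (allFin n)) ⟩
  List.sum (map (indicator ∘ P?) (cartesianProduct (allFin n) (allFin n)))
    ≡⟨ sum-cartesianProduct (indicator ∘ P?) (allFin n) (allFin n) ⟩
  List.sum (map (λ i → List.sum (map (λ j → indicator (P? (i , j))) (allFin n))) (allFin n))
    ≡⟨ sum-allFin (λ i → List.sum (map (λ j → indicator (P? (i , j))) (allFin n))) ⟩
  sum (λ i → List.sum (map (λ j → indicator (P? (i , j))) (allFin n)))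
    ≡⟨ sum-cong-≗ (λ i → sum-allFin (λ j → indicator (P? (i , j)))) ⟩
  sum (λ i → count (λ j → P? (i , j)))
    ∎
  where open ≡-Reasoning

allPairs-restrict : ∀ {A : Set} {P : Pred A 0ℓ} {R : A → A → Set} {xs} →
                    All P xs → AllPairs (λ x y → P x → P y → R x y) xs → AllPairs R xs
allPairs-restrict []         []         = []
allPairs-restrict (px ∷ pxs) (rx ∷ rxs) =
  All.zipWith (λ (py , r) → r px py) (pxs , rx) ∷ allPairs-restrict pxs rxs

InversionsStartIn : ∀ {n} → Pred (Fin n) 0ℓ → (Fin n → ℕ) → Set
InversionsStartIn E f = ∀ {x y} → x F.< y → f y < f x → E x

module _ {n} {E : Pred (Fin n) 0ℓ} where

  private
    no-first-lag : ∀ {f g : Fin n → ℕ} → Injective _≡_ _≡_ f → (∀ x → ∃[ y ] g y ≡ f x) →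
                   InversionsStartIn E g → (∀ {x} → E x → f x ≡ g x) →
                   ∀ {x} → (∀ {y} → y F.< x → f y ≡ g y) → ¬ f x < g x
    no-first-lag {f} {g} f-injective g-covers-f inversions agree {x} before fx<gx with g-covers-f x
    ... | y , gy≡fx with <-cmp (toℕ y) (toℕ x)
    ...   | tri< y<x _ _ = <-irrefl (cong toℕ (f-injective (trans (before y<x) gy≡fx))) y<x
    ...   | tri≈ _ y≡x _ = <-irrefl (trans (sym gy≡fx) (cong g (F.toℕ-injective y≡x))) fx<gx
    ...   | tri> _ _ x<y = <-irrefl (agree (inversions x<y (subst (_< g x) (sym gy≡fx) fx<gx))) fx<gx

  ≗-if-agree-on-inversion-starts : ∀ {f g : Fin n → ℕ} →
    Injective _≡_ _≡_ f → Injective _≡_ _≡_ g →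
    (∀ x → ∃[ y ] f y ≡ g x) → (∀ x → ∃[ y ] g y ≡ f x) →
    InversionsStartIn E f → InversionsStartIn E g →
    (∀ {x} → E x → f x ≡ g x) → ∀ x → f x ≡ g x
  ≗-if-agree-on-inversion-starts {f} {g} f-inj g-inj f-covers-g g-covers-f f-inversions g-inversions agree =
    WF.All.wfRec <-wellFounded 0ℓ (λ x → f x ≡ g x) step
    where
    step : ∀ x → (∀ {y} → y F.< x → f y ≡ g y) → f x ≡ g x
    step x before with <-cmp (f x) (g x)
    ... | tri< fx<gx _ _ = ⊥-elim (no-first-lag f-inj g-covers-f g-inversions agree before fx<gx)
    ... | tri≈ _ fx≡gx _ = fx≡gx
    ... | tri> _ _ gx<fx =
      ⊥-elim (no-first-lag g-inj f-covers-g f-inversions (sym ∘ agree) (sym ∘ before) gx<fx)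

InversionsFromExcedances : ∀ {n} → Permutation′ n → Set
InversionsFromExcedances π = ∀ {i j} → i F.< j → (π ⟨$⟩ʳ j) F.< (π ⟨$⟩ʳ i) → IsExc π i × ¬ IsExc π j

module _ {n} (π : Permutation′ n) where

  private
    π[_] : Fin n → Fin n
    π[ x ] = π ⟨$⟩ʳ x

    π-toℕ-injective : ∀ {x y} → toℕ π[ x ] ≡ toℕ π[ y ] → x ≡ y
    π-toℕ-injective = Injection.injective (Inverse⇒Injection π) ∘ F.toℕ-injective

    lower? : (x : Fin n) → Decidable (λ j → π[ j ] F.< π[ x ])
    lower? x j = π[ j ] F.<? π[ x ]

    before? : (x : Fin n) → Decidable (λ (j : Fin n) → j F.< x)
    before? x j = j F.<? x

    excedance? : Decidable (IsExc π)
    excedance? x = x F.<? π[ x ]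

    inverted? : (x : Fin n) → Decidable (λ j → x F.< j × π[ j ] F.< π[ x ])
    inverted? x j = (x F.<? j) ×-dec lower? x j

    count-before : ∀ x → count (before? x) ≡ toℕ x
    count-before x = count-toℕ< n (toℕ x) (<⇒≤ (F.toℕ<n x))

  smallerBefore : Fin n → ℕ
  smallerBefore x = count (lower? x ∩? before? x)

  inversionsFrom : Fin n → ℕ
  inversionsFrom x = count (inverted? x)

  -- Truncated subtraction makes this 0 off the excedances, so dexc π is its sum.
  excess : Fin n → ℕ
  excess x = toℕ π[ x ] ∸ toℕ x

  value≡smallerBefore+inversionsFrom : ∀ x → toℕ π[ x ] ≡ smallerBefore x + inversionsFrom x
  value≡smallerBefore+inversionsFrom x = begin
    toℕ π[ x ]
      ≡⟨ count-toℕ< n (toℕ π[ x ]) (<⇒≤ (F.toℕ<n π[ x ])) ⟨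
    count (λ (j : Fin n) → toℕ j <? toℕ π[ x ])
      ≡⟨ count-permute (λ j → toℕ j <? toℕ π[ x ]) π ⟨
    count (lower? x)
      ≡⟨ count-∩-∁ (lower? x) (before? x) ⟩
    smallerBefore x + count (lower? x ∩? ∁? (before? x))
      ≡⟨ cong (smallerBefore x +_) (count-cong (lower? x ∩? ∁? (before? x)) (inverted? x) after after⁻¹) ⟩
    smallerBefore x + inversionsFrom x
      ∎
    where
    open ≡-Reasoning
    after : ∀ {j} → π[ j ] F.< π[ x ] × ¬ j F.< x → x F.< j × π[ j ] F.< π[ x ]
    after (πj<πx , j≮x) = ≤∧≢⇒< (≮⇒≥ j≮x) x≢j , πj<πx
      where x≢j = λ x≡j → <-irrefl (cong (toℕ ∘ π[_]) (F.toℕ-injective (sym x≡j))) πj<πx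
    after⁻¹ : ∀ {j} → x F.< j × π[ j ] F.< π[ x ] → π[ j ] F.< π[ x ] × ¬ j F.< x
    after⁻¹ (x<j , πj<πx) = πj<πx , <-asym x<j

  smallerBefore≤position : ∀ x → smallerBefore x ≤ toℕ x
  smallerBefore≤position x =
    ≤-trans (count-mono (lower? x ∩? before? x) (before? x) proj₂) (≤-reflexive (count-before x))

  smallerBefore≡position⇔ : ∀ x → smallerBefore x ≡ toℕ x ⇔ (∀ {y} → y F.< x → π[ y ] F.< π[ x ])
  smallerBefore≡position⇔ x = mk⇔
    (λ eq {y} y<x → proj₁ (count-≡⇒⊇ smaller? (before? x) proj₂ (trans eq (sym (count-before x))) y<x))
    (λ below → trans (count-cong smaller? (before? x) proj₂ (λ y<x → below y<x , y<x)) (count-before x))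
    where smaller? = lower? x ∩? before? x

  inversionsFrom≡0⇔ : ∀ x → inversionsFrom x ≡ 0 ⇔ (∀ {y} → x F.< y → ¬ π[ y ] F.< π[ x ])
  inversionsFrom≡0⇔ x = mk⇔
    (λ eq {y} x<y πy<πx → count-≡0 (inverted? x) eq y (x<y , πy<πx))
    (λ none → count-∅ (inverted? x) λ y (x<y , πy<πx) → none x<y πy<πx)

  inversionsFrom≡value∸smallerBefore : ∀ x → inversionsFrom x ≡ toℕ π[ x ] ∸ smallerBefore x
  inversionsFrom≡value∸smallerBefore x =
    sym (trans (cong (_∸ smallerBefore x) (value≡smallerBefore+inversionsFrom x))
                (m+n∸m≡n (smallerBefore x) (inversionsFrom x)))

  excess≤inversionsFrom : ∀ x → excess x ≤ inversionsFrom x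
  excess≤inversionsFrom x = subst (excess x ≤_) (sym (inversionsFrom≡value∸smallerBefore x))
    (∸-monoʳ-≤ (toℕ π[ x ]) (smallerBefore≤position x))

  inv≡sum-inversionsFrom : inv π ≡ sum inversionsFrom
  inv≡sum-inversionsFrom =
    trans (length-filter-pairs {n} _) (sum-cong-≗ {n} λ i → count-cong {n} _ (inverted? i) id id)

  -- The summand of dexc is local to its definition; mutual lets unification name it.
  mutual
    dexc≡sum-excess : dexc π ≡ sum excess
    dexc≡sum-excess = trans (cong List.sum (map-cong summand≗excess (allFin n))) (sum-allFin excess)

    summand≗excess : ∀ x → _ ≡ excess x
    summand≗excess x with x F.<? π[ x ]
    ... | yes _   = refl
    ... | no  x≮πx = sym (m≤n⇒m∸n≡0 (≮⇒≥ x≮πx))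

  excess≡inversionsFrom⇒smallerBefore≡position : ∀ {x} → IsExc π x → excess x ≡ inversionsFrom x →
                                                 smallerBefore x ≡ toℕ x
  excess≡inversionsFrom⇒smallerBefore≡position {x} x<πx eq = sym (∸-cancelˡ-≡ (<⇒≤ x<πx)
    (≤-trans (smallerBefore≤position x) (<⇒≤ x<πx)) (trans eq (inversionsFrom≡value∸smallerBefore x)))

  excess≗inversionsFrom⇒inversionsFromExcedances : (∀ x → excess x ≡ inversionsFrom x) →
                                                   InversionsFromExcedances π
  excess≗inversionsFrom⇒inversionsFromExcedances eq {i} {j} i<j πj<πi = i-excedance , j-not-excedance
    where
    i-excedance : IsExc π i
    i-excedance with i F.<? π[ i ]
    ... | yes i<πi = i<πi
    ... | no  i≮πi = contradiction πj<πi
      (Equivalence.to (inversionsFrom≡0⇔ i) (trans (sym (eq i)) (m≤n⇒m∸n≡0 (≮⇒≥ i≮πi))) i<j)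
    j-not-excedance : ¬ IsExc π j
    j-not-excedance j<πj = <-asym πj<πi
      (Equivalence.to (smallerBefore≡position⇔ j)
        (excess≡inversionsFrom⇒smallerBefore≡position j<πj (eq j)) i<j)

  inversionsFromExcedances⇒excess≗inversionsFrom : InversionsFromExcedances π →
                                                   ∀ x → excess x ≡ inversionsFrom x
  inversionsFromExcedances⇒excess≗inversionsFrom cf x with x F.<? π[ x ]
  ... | yes x<πx = sym (trans (inversionsFrom≡value∸smallerBefore x)
    (cong (toℕ π[ x ] ∸_) (Equivalence.from (smallerBefore≡position⇔ x) below)))
    where
    below : ∀ {y} → y F.< x → π[ y ] F.< π[ x ]
    below {y} y<x with <-cmp (toℕ π[ y ]) (toℕ π[ x ])
    ... | tri< πy<πx _ _ = πy<πx
    ... | tri≈ _ πy≡πx _ = contradiction (cong toℕ (π-toℕ-injective πy≡πx)) (<⇒≢ y<x)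
    ... | tri> _ _ πx<πy = contradiction x<πx (proj₂ (cf y<x πx<πy))
  ... | no x≮πx = trans (m≤n⇒m∸n≡0 (≮⇒≥ x≮πx))
    (sym (Equivalence.from (inversionsFrom≡0⇔ x) λ x<y πy<πx → x≮πx (proj₁ (cf x<y πy<πx))))

  biIncreasing⇔inversionsFromExcedances : BiIncreasing π ⇔ InversionsFromExcedances π
  biIncreasing⇔inversionsFromExcedances = mk⇔ to from
    where
    to : BiIncreasing π → InversionsFromExcedances π
    to inv≡dexc = excess≗inversionsFrom⇒inversionsFromExcedances
      (sum-mono-≤-≡⇒≗ excess≤inversionsFrom
        (trans (sym dexc≡sum-excess) (trans (sym inv≡dexc) inv≡sum-inversionsFrom)))
    from : InversionsFromExcedances π → BiIncreasing π
    from cf = trans inv≡sum-inversionsFrom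
      (trans (sym (sum-cong-≗ (inversionsFromExcedances⇒excess≗inversionsFrom cf))) (sym dexc≡sum-excess))

  excedancePair : Fin n → ℕ × ℕ
  excedancePair x = suc (toℕ x) , toℕ π[ x ] ∸ toℕ x

  excedancePairs : List (ℕ × ℕ)
  excedancePairs = map excedancePair (filter excedance? (allFin n))

  excedancePair-end : ∀ {x} → IsExc π x → suc (toℕ x) + (toℕ π[ x ] ∸ toℕ x) ≡ suc (toℕ π[ x ])
  excedancePair-end x<πx = cong suc (m+[n∸m]≡n (<⇒≤ x<πx))

  ∈-excedancePairs⁺ : ∀ {x} → IsExc π x → excedancePair x ∈ excedancePairs
  ∈-excedancePairs⁺ {x} x<πx = ∈-map⁺ excedancePair (∈-filter⁺ excedance? (∈-allFin x) x<πx)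

  ∈-excedancePairs⁻ : ∀ {p} → p ∈ excedancePairs → ∃[ x ] IsExc π x × p ≡ excedancePair x
  ∈-excedancePairs⁻ mem with ∈-map∘filter⁻ excedancePair excedance? {xs = allFin n} mem
  ... | x , _ , p≡ , x<πx = x , x<πx , p≡

  excedancePairs-starts : ∀ {x} → suc (toℕ x) ∈ map proj₁ excedancePairs → IsExc π x
  excedancePairs-starts {x} mem with ∈-map⁻ proj₁ mem
  ... | _ , mem′ , refl with ∈-excedancePairs⁻ mem′
  ...   | y , y<πy , p≡ = subst (IsExc π) (F.toℕ-injective (suc-injective (cong proj₁ (sym p≡)))) y<πy

  module _ (cf : InversionsFromExcedances π) where

    excedancePairs-good : All (GoodPair n) excedancePairs
    excedancePairs-good = All.tabulate good
      where
      good : ∀ {p} → p ∈ excedancePairs → GoodPair n p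
      good mem with ∈-excedancePairs⁻ mem
      ... | x , x<πx , refl =
        s≤s z≤n , m<n⇒0<n∸m x<πx , ≤-trans (s≤s x<πx) πx<n ,
        subst (1 <_) (sym end) (s≤s (≤-trans (s≤s z≤n) x<πx)) , subst (_≤ n) (sym end) πx<n
        where
        end = excedancePair-end x<πx
        πx<n = F.toℕ<n π[ x ]

    excedancePairs-sorted : Sorted excedancePairs
    excedancePairs-sorted = AllPairs.map⁺ (allPairs-restrict (all-filter excedance? (allFin n))
      (AllPairs.filter⁺ excedance? (AllPairs.tabulate⁺-< increasing)))
      where
      increasing : ∀ {x y} → x F.< y → IsExc π x → IsExc π y →
                   IncrPair (excedancePair x) (excedancePair y)
      increasing {x} {y} x<y x<πx y<πy =
        s≤s x<y , subst₂ _<_ (sym (excedancePair-end x<πx)) (sym (excedancePair-end y<πy)) (s≤s πx<πy)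
        where
        πx<πy : toℕ π[ x ] < toℕ π[ y ]
        πx<πy with <-cmp (toℕ π[ x ]) (toℕ π[ y ])
        ... | tri< πx<πy _ _ = πx<πy
        ... | tri≈ _ πx≡πy _ = contradiction (cong toℕ (π-toℕ-injective πx≡πy)) (<⇒≢ x<y)
        ... | tri> _ _ πy<πx = contradiction y<πy (proj₂ (cf x<y πy<πx))

    excedancePairs-valid : ValidPairs n excedancePairs
    excedancePairs-valid = excedancePairs-good , AllPairs⇒Linked excedancePairs-sorted

    excedancePairs-represents : Represents π excedancePairs
    excedancePairs-represents =
      ≗-if-agree-on-inversion-starts f-injective g-injective f-covers-g g-covers-f f-inversions g-inversions agree
      where
      ps = excedancePairs
      f g : Fin n → ℕ
      f x = suc (toℕ π[ x ])
      g x = word ps (suc (toℕ x))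

      f-injective : Injective _≡_ _≡_ f
      f-injective = π-toℕ-injective ∘ suc-injective
      g-injective : Injective _≡_ _≡_ g
      g-injective = F.toℕ-injective ∘ suc-injective ∘ word-injective ps

      f-covers-g : ∀ x → ∃[ y ] f y ≡ g x
      f-covers-g x with inRange⇒suc-toℕ (word-inRange ps excedancePairs-good (suc-toℕ-inRange x))
      ... | z , gx≡z = π ⟨$⟩ˡ z , trans (cong (suc ∘ toℕ) (inverseʳ π)) (sym gx≡z)
      g-covers-f : ∀ x → ∃[ y ] g y ≡ f x
      g-covers-f x with word-surjective ps excedancePairs-good (suc-toℕ-inRange π[ x ])
      ... | p , p∈ , word-p≡fx with inRange⇒suc-toℕ p∈
      ...   | y , refl = y , word-p≡fx

      f-inversions : InversionsStartIn (IsExc π) f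
      f-inversions x<y fy<fx = proj₁ (cf x<y (≤-pred fy<fx))
      g-inversions : InversionsStartIn (IsExc π) g
      g-inversions x<y gy<gx = excedancePairs-starts (Equivalence.to
        (word-excedance⇔ ps positive excedancePairs-sorted _)
        (proj₁ (word-inversion ps positive excedancePairs-sorted (s≤s x<y) gy<gx)))
        where positive = valid⇒positive excedancePairs-valid

      agree : ∀ {x} → IsExc π x → f x ≡ g x
      agree x<πx =
        sym (trans (word-start ps excedancePairs-sorted (∈-excedancePairs⁺ x<πx)) (excedancePair-end x<πx))

module _ {n} {π : Permutation′ n} {ps} (valid : ValidPairs n ps) (represents : Represents π ps) where

  represented⇒inversionsFromExcedances : InversionsFromExcedances π
  represented⇒inversionsFromExcedances {i} {j} i<j πj<πi with
    word-inversion ps (valid⇒positive valid) (valid⇒sorted valid) (s≤s i<j)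
      (subst₂ _<_ (represents j) (represents i) (s≤s πj<πi))
  ... | i<word-i , word-j≤j =
    ≤-pred (subst (suc (toℕ i) <_) (sym (represents i)) i<word-i) ,
    λ j<πj → <⇒≱ j<πj (≤-pred (subst (_≤ suc (toℕ j)) (sym (represents j)) word-j≤j))

  represented⇒excedance⇔start : ∀ x → IsExc π x ⇔ suc (toℕ x) ∈ map proj₁ ps
  represented⇒excedance⇔start x = ⇔.trans
    (subst (λ v → IsExc π x ⇔ suc (toℕ x) < v) (represents x) (mk⇔ s≤s ≤-pred))
    (word-excedance⇔ ps (valid⇒positive valid) (valid⇒sorted valid) (suc (toℕ x)))

proposition2p2 : (n : ℕ) (π : Permutation′ n) →
    (BiIncreasing π ⇔ Σ (List (ℕ × ℕ)) (λ ps → ValidPairs n ps × Represents π ps))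
    × (∀ (ps : List (ℕ × ℕ)) → ValidPairs n ps → Represents π ps →
         ∀ (x : Fin n) → (IsExc π x ⇔ suc (toℕ x) ∈ map proj₁ ps))
proposition2p2 n π = mk⇔ represented represented⇒biIncreasing , λ _ → represented⇒excedance⇔start {π = π}
  where
  represented : BiIncreasing π → Σ (List (ℕ × ℕ)) (λ ps → ValidPairs n ps × Represents π ps)
  represented biIncreasing = excedancePairs π , excedancePairs-valid π cf , excedancePairs-represents π cf
    where cf = Equivalence.to (biIncreasing⇔inversionsFromExcedances π) biIncreasing
  represented⇒biIncreasing : Σ (List (ℕ × ℕ)) (λ ps → ValidPairs n ps × Represents π ps) → BiIncreasing π
  represented⇒biIncreasing (_ , valid , represents) = Equivalence.from (biIncreasing⇔inversionsFromExcedances π)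
    (represented⇒inversionsFromExcedances {π = π} valid represents)
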